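{- $\to_{EM}\ \subseteq\ \Longrightarrow\ \subseteq\ \to_{EM}^*$, where $\Longrightarrow$ is the parallel reduction of $PPC_{EM}$.
   Context: $PPC_{EM}$ terms: $t ::= x \mid \hat{x} \mid t\,t \mid t\bullet t \mid [\theta]\,t \to t \mid t\langle\theta \mid \mu \mid \Delta\rangle$ ($x$ names, $\theta$ lists of names), with $\bullet$ explicit structural application, $[\theta]p\to b$ pattern abstraction, $b\langle\theta\mid\mu\mid\Delta\rangle$ explicit matching with $\mu$ a decided match ($\bot$ or a substitution, a finite map from names to terms) and $\Delta$ a finite multiset of pairs of terms. Data structures: $\hat x$, $t\bullet t$; matchable forms: data structures and abstractions. $\bot$ as a term is a fixed closed normal term without $\bullet$ or matchings. $fn(t)$ is the set of free variables and free matchables, where $\theta$ in $[\theta]p\to b$ binds matchables of $p$ and variables of $b$, and in $b\langle\theta\mid\mu\mid\Delta\rangle$ binds variables of $b$ and matchables of second components of $\Delta$. $t^\sigma$ is capture-avoiding substitution of free variables, propagating through all constructors including $\mu$'s codomain and $\Delta$. Disjoint union $\uplus$: commutative, $\bot\uplus\mu=\bot$, $\sigma_1\uplus\sigma_2=\bot$ if domains overlap, union otherwise. Writing $(a,p)\Delta$ for multiset union with $\{(a,p)\}$, the rules of $PPC_{EM}$ are: (B) $([\theta]p\to b)\,a \to b\langle\theta\mid\emptyset\mid(a,p)\rangle$; ($\bullet$) $\hat x\,t\to \hat x\bullet t$, $(t_1\bullet t_2)\,t_3\to(t_1\bullet t_2)\bullet t_3$; (m) $b\langle\theta\mid\mu\mid(a,\hat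 x)\Delta\rangle\to b\langle\theta\mid\mu\uplus\{x\mapsto a\}\mid\Delta\rangle$ if $x\in\theta$, $fn(a)\cap\theta=\emptyset$; $b\langle\theta\mid\mu\mid(\hat x,\hat x)\Delta\rangle\to b\langle\theta\mid\mu\mid\Delta\rangle$ if $x\notin\theta$; $b\langle\theta\mid\mu\mid(a_1\bullet a_2,p_1\bullet p_2)\Delta\rangle\to b\langle\theta\mid\mu\mid(a_1,p_1)(a_2,p_2)\Delta\rangle$; and (failure) $b\langle\theta\mid\mu\mid(a,p)\Delta\rangle\to b\langle\theta\mid\bot\mid\Delta\rangle$ when: $a=\hat y,p=\hat x$, $x\notin\theta$, $x\neq y$; $a=a_1\bullet a_2$, $p=\hat x$, $x\notin\theta$; $a$ an abstraction, $p=\hat x$, $x\notin\theta$; $a=\hat x$, $p=p_1\bullet p_2$; $a$ an abstraction, $p=p_1\bullet p_2$; $p$ an abstraction. (r) $b\langle\theta\mid\sigma\mid\emptyset\rangle\to b^\sigma$ if $dom(\sigma)=\theta$; $\to\bot$ if $dom(\sigma)\neq\theta$; $b\langle\theta\mid\bot\mid\Delta\rangle\to\bot$. $\to_{EM}$ is the context closure of all rules. Parallel reduction $\Longrightarrow$ is the least relation closed under: $t\Longrightarrow t$; congruence ($t_1\Longrightarrow t_1',t_2\Longrightarrow t_2'$ give $t_1t_2\Longrightarrow t_1't_2'$ and $t_1\bullet t_2\Longrightarrow t_1'\bullet t_2'$; $p\Longrightarrow p',b\Longrightarrow b'$ give $[\theta]p\to b\Longrightarrow[\theta]p'\to b'$;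 $b\Longrightarrow b',\mu\Longrightarrow\mu',\Delta\Longrightarrow\Delta'$ give $b\langle\theta\mid\mu\mid\Delta\rangle\Longrightarrow b'\langle\theta\mid\mu'\mid\Delta'\rangle$); Init: $p\Longrightarrow p',b\Longrightarrow b',a\Longrightarrow a'$ give $([\theta]p\to b)a\Longrightarrow b'\langle\theta\mid\emptyset\mid(a',p')\rangle$; Struct: $t\Longrightarrow t'$ gives $\hat x\,t\Longrightarrow\hat x\bullet t'$, and $t_i\Longrightarrow t_i'$ ($i=1,2,3$) give $(t_1\bullet t_2)t_3\Longrightarrow(t_1'\bullet t_2')\bullet t_3'$; Match: with $b\Longrightarrow b'$, $\mu\Longrightarrow\mu'$, $\Delta\Longrightarrow\Delta'$: $b\langle\theta\mid\mu\mid(a,\hat x)\Delta\rangle\Longrightarrow b'\langle\theta\mid\mu'\uplus\{x\mapsto a'\}\mid\Delta'\rangle$ if $a\Longrightarrow a'$, $x\in\theta$, $fn(a)\cap\theta=\emptyset$; $b\langle\theta\mid\mu\mid(\hat x,\hat x)\Delta\rangle\Longrightarrow b'\langle\theta\mid\mu'\mid\Delta'\rangle$ if $x\notin\theta$; $b\langle\theta\mid\mu\mid(a_1\bullet a_2,p_1\bullet p_2)\Delta\rangle\Longrightarrow b'\langle\theta\mid\mu'\mid(a_1',p_1')(a_2',p_2')\Delta'\rangle$ if $a_i\Longrightarrow a_i'$, $p_i\Longrightarrow p_i'$; $b\langle\theta\mid\mu\mid(a,p)\Delta\rangle\Longrightarrow b'\langle\theta\mid\bot\mid\Delta'\rangle$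 for $a,p$ in any of the failure cases above; Res: $b\Longrightarrow b'$, $\sigma\Longrightarrow\sigma'$, $dom(\sigma)=\theta$ give $b\langle\theta\mid\sigma\mid\emptyset\rangle\Longrightarrow (b')^{\sigma'}$; $dom(\sigma)\neq\theta$ gives $b\langle\theta\mid\sigma\mid\emptyset\rangle\Longrightarrow\bot$; $b\langle\theta\mid\bot\mid\Delta\rangle\Longrightarrow\bot$. Parallel reduction is extended to decided matches by applying $\Longrightarrow$ to every term of the codomain of a substitution (with $\bot\Longrightarrow\bot$), and to multisets of pairs by applying it to all terms. -}

module Defs where

open import Data.Nat using (ℕ; zero; suc; _+_; _⊔_; _≟_)
open import Data.List using (List; []; _∷_; _++_; filter; map; foldr)
open import Data.Product using (_×_; _,_; proj₁; proj₂)
open import Relation.Nullary using (¬_; ¬?; yes; no)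
open import Relation.Binary.PropositionalEquality using (_≡_; _≢_)
open import Data.List.Membership.Propositional using (_∈_; _∉_)
open import Data.List.Membership.DecPropositional _≟_ using (_∈?_)
open import Data.List.Relation.Binary.Permutation.Propositional using (_↭_)
open import Relation.Binary.Construct.Closure.ReflexiveTransitive using (Star)

Name : Set
Name = ℕ

mutual
  -- var x = x ; mat x = x̂ ; app = juxtaposition ; dot = explicit •
  -- pabs θ p b = [θ] p → b ; emat b θ μ Δ = b⟨θ | μ | Δ⟩
  data Term : Set where
    var  : Name → Term
    mat  : Name → Term
    app  : Term → Term → Term
    dot  : Term → Term → Term
    pabs : List Name → Term → Term → Term
    emat : Term → List Name → DMatch → List (Term × Term) → Term

  -- decided matches: ⊥ (fail) or a substitution (finite map, as an
  -- association list)
  data DMatch : Set where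
    fail  : DMatch
    subst : List (Name × Term) → DMatch

Subst : Set
Subst = List (Name × Term)

Pairs : Set
Pairs = List (Term × Term)

dom : Subst → List Name
dom = map proj₁

-- the fixed closed normal term ⊥ (no •, no matchings):  [x] x̂ → x
botT : Term
botT = pabs (0 ∷ []) (mat 0) (var 0)

remove : List Name → List Name → List Name
remove θ = filter (λ x → ¬? (x ∈? θ))

mutual
  fv : Term → List Name
  fv (var x) = x ∷ []
  fv (mat x) = []
  fv (app s t) = fv s ++ fv t
  fv (dot s t) = fv s ++ fv t
  fv (pabs θ p b) = fv p ++ remove θ (fv b)
  fv (emat b θ μ Δ) = remove θ (fv b) ++ fvM μ ++ fv₁ Δ ++ fv₂ Δ

  fvM : DMatch → List Name
  fvM fail = []
  fvM (subst σ) = fvS σ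

  fvS : Subst → List Name
  fvS [] = []
  fvS ((x , t) ∷ σ) = fv t ++ fvS σ

  fv₁ : Pairs → List Name
  fv₁ [] = []
  fv₁ ((a , p) ∷ Δ) = fv a ++ fv₁ Δ

  fv₂ : Pairs → List Name
  fv₂ [] = []
  fv₂ ((a , p) ∷ Δ) = fv p ++ fv₂ Δ

mutual
  fm : Term → List Name
  fm (var x) = []
  fm (mat x) = x ∷ []
  fm (app s t) = fm s ++ fm t
  fm (dot s t) = fm s ++ fm t
  fm (pabs θ p b) = remove θ (fm p) ++ fm b
  fm (emat b θ μ Δ) = fm b ++ fmM μ ++ fm₁ Δ ++ remove θ (fm₂ Δ)

  fmM : DMatch → List Name
  fmM fail = []
  fmM (subst σ) = fmS σ

  fmS : Subst → List Name
  fmS [] = []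
  fmS ((x , t) ∷ σ) = fm t ++ fmS σ

  fm₁ : Pairs → List Name
  fm₁ [] = []
  fm₁ ((a , p) ∷ Δ) = fm a ++ fm₁ Δ

  fm₂ : Pairs → List Name
  fm₂ [] = []
  fm₂ ((a , p) ∷ Δ) = fm p ++ fm₂ Δ

fn : Term → List Name
fn t = fv t ++ fm t

-- capture-avoiding substitution t^σ
-- Every binder list θ is renamed to fresh names (x ↦ c + x, with c above
-- every name in sight), which is an α-conversion; then the substitution is
-- pushed through all constructors.

maxL : List Name → ℕ
maxL = foldr _⊔_ 0

mutual
  maxN : Term → ℕ
  maxN (var x) = x
  maxN (mat x) = x
  maxN (app s t) = maxN s ⊔ maxN t
  maxN (dot s t) = maxN s ⊔ maxN t
  maxN (pabs θ p b) = maxL θ ⊔ maxN p ⊔ maxN b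
  maxN (emat b θ μ Δ) = maxN b ⊔ maxL θ ⊔ maxM μ ⊔ maxP Δ

  maxM : DMatch → ℕ
  maxM fail = 0
  maxM (subst σ) = maxS σ

  maxS : Subst → ℕ
  maxS [] = 0
  maxS ((x , t) ∷ σ) = x ⊔ maxN t ⊔ maxS σ

  maxP : Pairs → ℕ
  maxP [] = 0
  maxP ((a , p) ∷ Δ) = maxN a ⊔ maxN p ⊔ maxP Δ

lookupS : Subst → Name → Term
lookupS [] x = var x
lookupS ((y , t) ∷ σ) x with x ≟ y
... | yes _ = t
... | no _ = lookupS σ x

renB : List Name → ℕ → Name → Name
renB θ c x with x ∈? θ
... | yes _ = c + x
... | no _ = x

extV : (Name → Term) → List Name → ℕ → Name → Term
extV V θ c x with x ∈? θ
... | yes _ = var (c + x)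
... | no _ = V x

extM : (Name → Name) → List Name → ℕ → Name → Name
extM M θ c x with x ∈? θ
... | yes _ = c + x
... | no _ = M x

next : List Name → ℕ → ℕ
next θ c = c + suc (maxL θ)

mutual
  -- V : action on free variables, M : renaming of free matchables,
  -- c : lower bound for fresh names
  sub : (Name → Term) → (Name → Name) → ℕ → Term → Term
  sub V M c (var x) = V x
  sub V M c (mat x) = mat (M x)
  sub V M c (app s t) = app (sub V M c s) (sub V M c t)
  sub V M c (dot s t) = dot (sub V M c s) (sub V M c t)
  sub V M c (pabs θ p b) =
    pabs (map (c +_) θ) (sub V (extM M θ c) (next θ c) p)
                        (sub (extV V θ c) M (next θ c) b)
  sub V M c (emat b θ μ Δ) =
    emat (sub (extV V θ c) M (next θ c) b) (map (c +_) θ)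
         (subM V M (next θ c) (renB θ c) μ)
         (subP V M (extM M θ c) (next θ c) Δ)

  subM : (Name → Term) → (Name → Name) → ℕ → (Name → Name) → DMatch → DMatch
  subM V M c R fail = fail
  subM V M c R (subst σ) = subst (subS V M c R σ)

  -- keys of the decided match are renamed along with θ (R)
  subS : (Name → Term) → (Name → Name) → ℕ → (Name → Name) → Subst → Subst
  subS V M c R [] = []
  subS V M c R ((x , t) ∷ σ) = (R x , sub V M c t) ∷ subS V M c R σ

  -- first components: not under θ; second components: matchables of θ bound
  subP : (Name → Term) → (Name → Name) → (Name → Name) → ℕ → Pairs → Pairs
  subP V M M' c [] = []
  subP V M M' c ((a , p) ∷ Δ) = (sub V M c a , sub V M' c p) ∷ subP V M M' c Δ

_^_ : Term → Subst → Term
t ^ σ = sub (lookupS σ) (λ x → x) (suc (maxN t ⊔ maxS σ)) t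

disjointB : List Name → List Name → DMatch → DMatch
disjointB [] ys r = r
disjointB (x ∷ xs) ys r with x ∈? ys
... | yes _ = fail
... | no _ = disjointB xs ys r

_⊎ₘ_ : DMatch → DMatch → DMatch
fail ⊎ₘ μ = fail
subst σ ⊎ₘ fail = fail
subst σ₁ ⊎ₘ subst σ₂ = disjointB (dom σ₁) (dom σ₂) (subst (σ₁ ++ σ₂))

DomEq : Subst → List Name → Set
DomEq σ θ = ∀ x → (x ∈ dom σ → x ∈ θ) × (x ∈ θ → x ∈ dom σ)

FnDisj : Term → List Name → Set
FnDisj a θ = ∀ x → x ∈ fn a → x ∉ θ

data Fails (θ : List Name) : Term → Term → Set where
  f-mm : ∀ {x y} → x ∉ θ → x ≢ y → Fails θ (mat y) (mat x)
  f-dm : ∀ {x a₁ a₂} → x ∉ θ → Fails θ (dot a₁ a₂) (mat x)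
  f-am : ∀ {x θ' q c} → x ∉ θ → Fails θ (pabs θ' q c) (mat x)
  f-md : ∀ {x p₁ p₂} → Fails θ (mat x) (dot p₁ p₂)
  f-ad : ∀ {θ' q c p₁ p₂} → Fails θ (pabs θ' q c) (dot p₁ p₂)
  f-pa : ∀ {a θ' q c} → Fails θ a (pabs θ' q c)

-- root rules of PPC_EM.  "(a,p)Δ" (multiset union) is rendered as a
-- list Δ that is a permutation of (a,p) ∷ Δ₀.

single : Name → Term → DMatch
single x a = subst ((x , a) ∷ [])

data _↦_ : Term → Term → Set where
  B    : ∀ {θ p b a} → app (pabs θ p b) a ↦ emat b θ (subst []) ((a , p) ∷ [])
  S₁   : ∀ {x t} → app (mat x) t ↦ dot (mat x) t
  S₂   : ∀ {t₁ t₂ t₃} → app (dot t₁ t₂) t₃ ↦ dot (dot t₁ t₂) t₃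
  m₁   : ∀ {b θ μ Δ Δ₀ a x} → Δ ↭ ((a , mat x) ∷ Δ₀) → x ∈ θ → FnDisj a θ →
         emat b θ μ Δ ↦ emat b θ (μ ⊎ₘ single x a) Δ₀
  m₂   : ∀ {b θ μ Δ Δ₀ x} → Δ ↭ ((mat x , mat x) ∷ Δ₀) → x ∉ θ →
         emat b θ μ Δ ↦ emat b θ μ Δ₀
  m₃   : ∀ {b θ μ Δ Δ₀ a₁ a₂ p₁ p₂} → Δ ↭ ((dot a₁ a₂ , dot p₁ p₂) ∷ Δ₀) →
         emat b θ μ Δ ↦ emat b θ μ ((a₁ , p₁) ∷ (a₂ , p₂) ∷ Δ₀)
  mfail : ∀ {b θ μ Δ Δ₀ a p} → Δ ↭ ((a , p) ∷ Δ₀) → Fails θ a p →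
         emat b θ μ Δ ↦ emat b θ fail Δ₀
  r₁   : ∀ {b θ σ} → DomEq σ θ → emat b θ (subst σ) [] ↦ (b ^ σ)
  r₂   : ∀ {b θ σ} → ¬ DomEq σ θ → emat b θ (subst σ) [] ↦ botT
  r₃   : ∀ {b θ Δ} → emat b θ fail Δ ↦ botT

mutual
  data _⟶_ : Term → Term → Set where
    root  : ∀ {t u} → t ↦ u → t ⟶ u
    appL  : ∀ {s s' t} → s ⟶ s' → app s t ⟶ app s' t
    appR  : ∀ {s t t'} → t ⟶ t' → app s t ⟶ app s t'
    dotL  : ∀ {s s' t} → s ⟶ s' → dot s t ⟶ dot s' t
    dotR  : ∀ {s t t'} → t ⟶ t' → dot s t ⟶ dot s t'
    absP  : ∀ {θ p p' b} → p ⟶ p' → pabs θ p b ⟶ pabs θ p' b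
    absB  : ∀ {θ p b b'} → b ⟶ b' → pabs θ p b ⟶ pabs θ p b'
    ematB : ∀ {b b' θ μ Δ} → b ⟶ b' → emat b θ μ Δ ⟶ emat b' θ μ Δ
    ematM : ∀ {b θ σ σ' Δ} → σ ⟶S σ' → emat b θ (subst σ) Δ ⟶ emat b θ (subst σ') Δ
    ematΔ : ∀ {b θ μ Δ Δ'} → Δ ⟶P Δ' → emat b θ μ Δ ⟶ emat b θ μ Δ'

  data _⟶S_ : Subst → Subst → Set where
    here  : ∀ {x t t' σ} → t ⟶ t' → ((x , t) ∷ σ) ⟶S ((x , t') ∷ σ)
    there : ∀ {e σ σ'} → σ ⟶S σ' → (e ∷ σ) ⟶S (e ∷ σ')

  data _⟶P_ : Pairs → Pairs → Set where
    hereL : ∀ {a a' p Δ} → a ⟶ a' → ((a , p) ∷ Δ) ⟶P ((a' , p) ∷ Δ)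
    hereR : ∀ {a p p' Δ} → p ⟶ p' → ((a , p) ∷ Δ) ⟶P ((a , p') ∷ Δ)
    there : ∀ {e Δ Δ'} → Δ ⟶P Δ' → (e ∷ Δ) ⟶P (e ∷ Δ')

_⟶*_ : Term → Term → Set
_⟶*_ = Star _⟶_

mutual
  data _⟹_ : Term → Term → Set where
    refl  : ∀ {t} → t ⟹ t
    app   : ∀ {s s' t t'} → s ⟹ s' → t ⟹ t' → app s t ⟹ app s' t'
    dot   : ∀ {s s' t t'} → s ⟹ s' → t ⟹ t' → dot s t ⟹ dot s' t'
    pabs  : ∀ {θ p p' b b'} → p ⟹ p' → b ⟹ b' → pabs θ p b ⟹ pabs θ p' b'
    emat  : ∀ {b b' θ μ μ' Δ Δ'} → b ⟹ b' → μ ⟹M μ' → Δ ⟹P Δ' →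
            emat b θ μ Δ ⟹ emat b' θ μ' Δ'
    init  : ∀ {θ p p' b b' a a'} → p ⟹ p' → b ⟹ b' → a ⟹ a' →
            app (pabs θ p b) a ⟹ emat b' θ (subst []) ((a' , p') ∷ [])
    st₁   : ∀ {x t t'} → t ⟹ t' → app (mat x) t ⟹ dot (mat x) t'
    st₂   : ∀ {t₁ t₁' t₂ t₂' t₃ t₃'} → t₁ ⟹ t₁' → t₂ ⟹ t₂' → t₃ ⟹ t₃' →
            app (dot t₁ t₂) t₃ ⟹ dot (dot t₁' t₂') t₃'
    pm₁   : ∀ {b b' θ μ μ' Δ Δ₀ Δ₀' a a' x} → b ⟹ b' → μ ⟹M μ' →
            Δ ↭ ((a , mat x) ∷ Δ₀) → Δ₀ ⟹P Δ₀' → a ⟹ a' → x ∈ θ → FnDisj a θ →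
            emat b θ μ Δ ⟹ emat b' θ (μ' ⊎ₘ single x a') Δ₀'
    pm₂   : ∀ {b b' θ μ μ' Δ Δ₀ Δ₀' x} → b ⟹ b' → μ ⟹M μ' →
            Δ ↭ ((mat x , mat x) ∷ Δ₀) → Δ₀ ⟹P Δ₀' → x ∉ θ →
            emat b θ μ Δ ⟹ emat b' θ μ' Δ₀'
    pm₃   : ∀ {b b' θ μ μ' Δ Δ₀ Δ₀' a₁ a₁' a₂ a₂' p₁ p₁' p₂ p₂'} →
            b ⟹ b' → μ ⟹M μ' →
            Δ ↭ ((dot a₁ a₂ , dot p₁ p₂) ∷ Δ₀) → Δ₀ ⟹P Δ₀' →
            a₁ ⟹ a₁' → a₂ ⟹ a₂' → p₁ ⟹ p₁' → p₂ ⟹ p₂' →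
            emat b θ μ Δ ⟹ emat b' θ μ' ((a₁' , p₁') ∷ (a₂' , p₂') ∷ Δ₀')
    pmf   : ∀ {b b' θ μ Δ Δ₀ Δ₀' a p} → b ⟹ b' →
            Δ ↭ ((a , p) ∷ Δ₀) → Δ₀ ⟹P Δ₀' → Fails θ a p →
            emat b θ μ Δ ⟹ emat b' θ fail Δ₀'
    res₁  : ∀ {b b' θ σ σ'} → b ⟹ b' → σ ⟹S σ' → DomEq σ θ →
            emat b θ (subst σ) [] ⟹ (b' ^ σ')
    res₂  : ∀ {b θ σ} → ¬ DomEq σ θ → emat b θ (subst σ) [] ⟹ botT
    res₃  : ∀ {b θ Δ} → emat b θ fail Δ ⟹ botT

  data _⟹M_ : DMatch → DMatch → Set where
    fail  : fail ⟹M fail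
    subst : ∀ {σ σ'} → σ ⟹S σ' → subst σ ⟹M subst σ'

  data _⟹S_ : Subst → Subst → Set where
    []  : [] ⟹S []
    _∷_ : ∀ {x t t' σ σ'} → t ⟹ t' → σ ⟹S σ' → ((x , t) ∷ σ) ⟹S ((x , t') ∷ σ')

  data _⟹P_ : Pairs → Pairs → Set where
    []  : [] ⟹P []
    cons : ∀ {a a' p p' Δ Δ'} → a ⟹ a' → p ⟹ p' → Δ ⟹P Δ' →
           ((a , p) ∷ Δ) ⟹P ((a' , p') ∷ Δ')

-- Every root rule of →EM is the instance of a parallel rule whose premises are
-- all reflexive, so one step is a parallel step.  Conversely a parallel step
-- is simulated by firing its root rule on the unreduced term and performing
-- the sub-reductions inside the result (for resolution: in the substitution
-- first, then the rule).  This reordering is sound because parallel reduction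
-- of a substitution keeps its domain, so neither the side condition
-- dom(σ) = θ nor the overlap test of ⊎ is affected.
module Submission where

open import Defs
open import Data.Product using (_×_; _,_; proj₁; proj₂)
open import Data.List using ([]; _∷_; _++_)
open import Data.List.Membership.Propositional using (_∈_)
open import Data.Nat using (_≟_)
open import Data.List.Membership.DecPropositional _≟_ using (_∈?_)
open import Relation.Binary.PropositionalEquality
  using (_≡_; refl; sym; cong) renaming (subst to transport)
open import Relation.Nullary using (yes; no)
open import Relation.Binary.Construct.Closure.ReflexiveTransitive
  using (Star; ε; _◅_; _◅◅_; gmap)

_⟶S*_ : Subst → Subst → Set
_⟶S*_ = Star _⟶S_

_⟶P*_ : Pairs → Pairs → Set
_⟶P*_ = Star _⟶P_

⟹S-refl : ∀ {σ} → σ ⟹S σ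
⟹S-refl {[]}    = []
⟹S-refl {_ ∷ _} = refl ∷ ⟹S-refl

⟹M-refl : ∀ {μ} → μ ⟹M μ
⟹M-refl {fail}    = fail
⟹M-refl {subst _} = subst ⟹S-refl

⟹P-refl : ∀ {Δ} → Δ ⟹P Δ
⟹P-refl {[]}    = []
⟹P-refl {_ ∷ _} = cons refl refl ⟹P-refl

↦⇒⟹ : ∀ {t u} → t ↦ u → t ⟹ u
↦⇒⟹ B               = init refl refl refl
↦⇒⟹ S₁              = st₁ refl
↦⇒⟹ S₂              = st₂ refl refl refl
↦⇒⟹ (m₁ perm x∈θ d) = pm₁ refl ⟹M-refl perm ⟹P-refl refl x∈θ d
↦⇒⟹ (m₂ perm x∉θ)   = pm₂ refl ⟹M-refl perm ⟹P-refl x∉θ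
↦⇒⟹ (m₃ perm)       = pm₃ refl ⟹M-refl perm ⟹P-refl refl refl refl refl
↦⇒⟹ (mfail perm f)  = pmf refl perm ⟹P-refl f
↦⇒⟹ (r₁ d)          = res₁ refl ⟹S-refl d
↦⇒⟹ (r₂ d)          = res₂ d
↦⇒⟹ r₃              = res₃

mutual
  ⟶⇒⟹ : ∀ {t u} → t ⟶ u → t ⟹ u
  ⟶⇒⟹ (root r)  = ↦⇒⟹ r
  ⟶⇒⟹ (appL s)  = app (⟶⇒⟹ s) refl
  ⟶⇒⟹ (appR s)  = app refl (⟶⇒⟹ s)
  ⟶⇒⟹ (dotL s)  = dot (⟶⇒⟹ s) refl
  ⟶⇒⟹ (dotR s)  = dot refl (⟶⇒⟹ s)
  ⟶⇒⟹ (absP s)  = pabs (⟶⇒⟹ s) refl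
  ⟶⇒⟹ (absB s)  = pabs refl (⟶⇒⟹ s)
  ⟶⇒⟹ (ematB s) = emat (⟶⇒⟹ s) ⟹M-refl ⟹P-refl
  ⟶⇒⟹ (ematM s) = emat refl (subst (⟶S⇒⟹S s)) ⟹P-refl
  ⟶⇒⟹ (ematΔ s) = emat refl ⟹M-refl (⟶P⇒⟹P s)

  ⟶S⇒⟹S : ∀ {σ σ'} → σ ⟶S σ' → σ ⟹S σ'
  ⟶S⇒⟹S (here s)  = ⟶⇒⟹ s ∷ ⟹S-refl
  ⟶S⇒⟹S (there s) = refl ∷ ⟶S⇒⟹S s

  ⟶P⇒⟹P : ∀ {Δ Δ'} → Δ ⟶P Δ' → Δ ⟹P Δ'
  ⟶P⇒⟹P (hereL s) = cons (⟶⇒⟹ s) refl ⟹P-refl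
  ⟶P⇒⟹P (hereR s) = cons refl (⟶⇒⟹ s) ⟹P-refl
  ⟶P⇒⟹P (there s) = cons refl refl (⟶P⇒⟹P s)

⟹S-dom : ∀ {σ σ'} → σ ⟹S σ' → dom σ ≡ dom σ'
⟹S-dom []                  = refl
⟹S-dom (_∷_ {x = x} _ σ⟹σ') = cong (x ∷_) (⟹S-dom σ⟹σ')

DomEq-resp-dom : ∀ {σ σ' θ} → dom σ ≡ dom σ' → DomEq σ θ → DomEq σ' θ
DomEq-resp-dom eq d x =
  (λ x∈σ' → proj₁ (d x) (transport (x ∈_) (sym eq) x∈σ')) ,
  (λ x∈θ → transport (x ∈_) eq (proj₂ (d x) x∈θ))

-- The test of ⊎ₘ only looks at the domains, so it commutes with any relation
-- between its possible outcomes that holds between two failures.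
disjointB-mono : (R : DMatch → DMatch → Set) → R fail fail →
                 ∀ ks ys {μ μ'} → R μ μ' → R (disjointB ks ys μ) (disjointB ks ys μ')
disjointB-mono R R-fail []       ys r = r
disjointB-mono R R-fail (k ∷ ks) ys r with k ∈? ys
... | yes _ = R-fail
... | no  _ = disjointB-mono R R-fail ks ys r

app-⟶* : ∀ {s s' t t'} → s ⟶* s' → t ⟶* t' → app s t ⟶* app s' t'
app-⟶* s⟶* t⟶* = gmap _ appL s⟶* ◅◅ gmap _ appR t⟶*

dot-⟶* : ∀ {s s' t t'} → s ⟶* s' → t ⟶* t' → dot s t ⟶* dot s' t'
dot-⟶* s⟶* t⟶* = gmap _ dotL s⟶* ◅◅ gmap _ dotR t⟶*

pabs-⟶* : ∀ {θ p p' b b'} → p ⟶* p' → b ⟶* b' → pabs θ p b ⟶* pabs θ p' b'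
pabs-⟶* p⟶* b⟶* = gmap _ absP p⟶* ◅◅ gmap _ absB b⟶*

emat-body-⟶* : ∀ {b b' θ μ Δ} → b ⟶* b' → emat b θ μ Δ ⟶* emat b' θ μ Δ
emat-body-⟶* = gmap _ ematB

emat-subst-⟶* : ∀ {b θ σ σ' Δ} → σ ⟶S* σ' →
                emat b θ (subst σ) Δ ⟶* emat b θ (subst σ') Δ
emat-subst-⟶* = gmap _ ematM

emat-pairs-⟶* : ∀ {b θ μ Δ Δ'} → Δ ⟶P* Δ' → emat b θ μ Δ ⟶* emat b θ μ Δ'
emat-pairs-⟶* = gmap _ ematΔ

∷-⟶S* : ∀ {x t t' σ σ'} → t ⟶* t' → σ ⟶S* σ' → ((x , t) ∷ σ) ⟶S* ((x , t') ∷ σ')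
∷-⟶S* t⟶* σ⟶* = gmap _ here t⟶* ◅◅ gmap _ there σ⟶*

∷-⟶P* : ∀ {a a' p p' Δ Δ'} → a ⟶* a' → p ⟶* p' → Δ ⟶P* Δ' →
        ((a , p) ∷ Δ) ⟶P* ((a' , p') ∷ Δ')
∷-⟶P* a⟶* p⟶* Δ⟶* = gmap _ hereL a⟶* ◅◅ gmap _ hereR p⟶* ◅◅ gmap _ there Δ⟶*

++ʳ-⟶S : ∀ {σ σ'} ρ → σ ⟶S σ' → (σ ++ ρ) ⟶S (σ' ++ ρ)
++ʳ-⟶S ρ (here s)  = here s
++ʳ-⟶S ρ (there s) = there (++ʳ-⟶S ρ s)

++ˡ-⟶S* : ∀ σ {ρ ρ'} → ρ ⟶S* ρ' → (σ ++ ρ) ⟶S* (σ ++ ρ')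
++ˡ-⟶S* []      ρ⟶* = ρ⟶*
++ˡ-⟶S* (e ∷ σ) ρ⟶* = gmap _ there (++ˡ-⟶S* σ ρ⟶*)

++-⟶S* : ∀ {σ σ' ρ ρ'} → σ ⟶S* σ' → ρ ⟶S* ρ' → (σ ++ ρ) ⟶S* (σ' ++ ρ')
++-⟶S* {σ' = σ'} {ρ} σ⟶* ρ⟶* = gmap _ (++ʳ-⟶S ρ) σ⟶* ◅◅ ++ˡ-⟶S* σ' ρ⟶*

mutual
  ⟹⇒⟶* : ∀ {t u} → t ⟹ u → t ⟶* u
  ⟹⇒⟶* refl             = ε
  ⟹⇒⟶* (app s t)        = app-⟶* (⟹⇒⟶* s) (⟹⇒⟶* t)
  ⟹⇒⟶* (dot s t)        = dot-⟶* (⟹⇒⟶* s) (⟹⇒⟶* t)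
  ⟹⇒⟶* (pabs p b)       = pabs-⟶* (⟹⇒⟶* p) (⟹⇒⟶* b)
  ⟹⇒⟶* (emat b μ Δ)     =
    emat-body-⟶* (⟹⇒⟶* b) ◅◅ ⟹M⇒⟶* μ ◅◅ emat-pairs-⟶* (⟹P⇒⟶P* Δ)
  ⟹⇒⟶* (init p b a)     =
    root B ◅ emat-body-⟶* (⟹⇒⟶* b) ◅◅ emat-pairs-⟶* (∷-⟶P* (⟹⇒⟶* a) (⟹⇒⟶* p) ε)
  ⟹⇒⟶* (st₁ t)          = root S₁ ◅ dot-⟶* ε (⟹⇒⟶* t)
  ⟹⇒⟶* (st₂ t₁ t₂ t₃)   =
    root S₂ ◅ dot-⟶* (dot-⟶* (⟹⇒⟶* t₁) (⟹⇒⟶* t₂)) (⟹⇒⟶* t₃)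
  ⟹⇒⟶* (pm₁ b μ perm Δ a x∈θ d) =
    root (m₁ perm x∈θ d) ◅ emat-body-⟶* (⟹⇒⟶* b)
      ◅◅ ⊎ₘ-single-⟶* μ (⟹⇒⟶* a) ◅◅ emat-pairs-⟶* (⟹P⇒⟶P* Δ)
  ⟹⇒⟶* (pm₂ b μ perm Δ x∉θ) =
    root (m₂ perm x∉θ) ◅ emat-body-⟶* (⟹⇒⟶* b)
      ◅◅ ⟹M⇒⟶* μ ◅◅ emat-pairs-⟶* (⟹P⇒⟶P* Δ)
  ⟹⇒⟶* (pm₃ b μ perm Δ a₁ a₂ p₁ p₂) =
    root (m₃ perm) ◅ emat-body-⟶* (⟹⇒⟶* b) ◅◅ ⟹M⇒⟶* μ
      ◅◅ emat-pairs-⟶* (∷-⟶P* (⟹⇒⟶* a₁) (⟹⇒⟶* p₁)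
                          (∷-⟶P* (⟹⇒⟶* a₂) (⟹⇒⟶* p₂) (⟹P⇒⟶P* Δ)))
  ⟹⇒⟶* (pmf b perm Δ f) =
    root (mfail perm f) ◅ emat-body-⟶* (⟹⇒⟶* b) ◅◅ emat-pairs-⟶* (⟹P⇒⟶P* Δ)
  ⟹⇒⟶* (res₁ b σ d)     =
    emat-body-⟶* (⟹⇒⟶* b) ◅◅ emat-subst-⟶* (⟹S⇒⟶S* σ)
      ◅◅ root (r₁ (DomEq-resp-dom (⟹S-dom σ) d)) ◅ ε
  ⟹⇒⟶* (res₂ d)         = root (r₂ d) ◅ ε
  ⟹⇒⟶* res₃             = root r₃ ◅ ε

  ⟹M⇒⟶* : ∀ {μ μ' b θ Δ} → μ ⟹M μ' → emat b θ μ Δ ⟶* emat b θ μ' Δ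
  ⟹M⇒⟶* fail      = ε
  ⟹M⇒⟶* (subst σ) = emat-subst-⟶* (⟹S⇒⟶S* σ)

  ⊎ₘ-single-⟶* : ∀ {μ μ' b θ Δ x a a'} → μ ⟹M μ' → a ⟶* a' →
                 emat b θ (μ ⊎ₘ single x a) Δ ⟶* emat b θ (μ' ⊎ₘ single x a') Δ
  ⊎ₘ-single-⟶*                       fail      _   = ε
  ⊎ₘ-single-⟶* {b = b} {θ} {Δ} {x} (subst {σ' = σ'} σ⟹σ') a⟶*
    rewrite ⟹S-dom σ⟹σ' =
    disjointB-mono (λ μ μ' → emat b θ μ Δ ⟶* emat b θ μ' Δ) ε (dom σ') (x ∷ [])
      (emat-subst-⟶* (++-⟶S* (⟹S⇒⟶S* σ⟹σ') (∷-⟶S* a⟶* ε)))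

  ⟹S⇒⟶S* : ∀ {σ σ'} → σ ⟹S σ' → σ ⟶S* σ'
  ⟹S⇒⟶S* []      = ε
  ⟹S⇒⟶S* (t ∷ σ) = ∷-⟶S* (⟹⇒⟶* t) (⟹S⇒⟶S* σ)

  ⟹P⇒⟶P* : ∀ {Δ Δ'} → Δ ⟹P Δ' → Δ ⟶P* Δ'
  ⟹P⇒⟶P* []           = ε
  ⟹P⇒⟶P* (cons a p Δ) = ∷-⟶P* (⟹⇒⟶* a) (⟹⇒⟶* p) (⟹P⇒⟶P* Δ)

mainTheorem5 : (∀ {t u} → t ⟶ u → t ⟹ u) × (∀ {t u} → t ⟹ u → t ⟶* u)
mainTheorem5 = ⟶⇒⟹ , ⟹⇒⟶*
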